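{- Let $L$ be a sub-classical logic that extends $\mathbf{IPC}$. Then there is no sequent calculus for $L$ consisting only of focused rules and the axioms $(\Gamma,r\Rightarrow r,\Delta)$ for atoms $r$, $(\Gamma,\bot\Rightarrow\Delta)$ and $(\Gamma\Rightarrow\top,\Delta)$.
   Context: Language of propositional logic ($\wedge,\vee,\to,\neg,\top,\bot$), with fusion, addition, $1$, $0$ read as $\wedge,\vee,\top,\bot$. A logic $L$ is sub-classical if every theorem of $L$ is a classical tautology, and extends $\mathbf{IPC}$ if it contains all intuitionistic theorems. Sequents $\Gamma\Rightarrow\Delta$ are multi-conclusion with finite multisets; a calculus $G$ is a sequent calculus for $L$ if $G\vdash\Gamma\Rightarrow\Delta$ iff $L\vdash\bigwedge\Gamma\to\bigvee\Delta$. $\Gamma,\Delta$ in the axioms are arbitrary contexts. Rules are schemes over meta-formulas (formulas with formula variables; $V$ = variables/atoms occurring) and meta-multiset variables. Focused rules: left: premises $\Gamma_i,\bar\phi_{ir}\Rightarrow\Delta_i$, conclusion $\Gamma_1,\dots,\Gamma_n,\phi\Rightarrow\Delta_1,\dots,\Delta_n$; right: premises $\Gamma_i\Rightarrow\bar\phi_{ir},\Delta_i$, conclusion $\Gamma_1,\dots,\Gamma_n\Rightarrow\Delta_1,\dots,\Delta_n,\phi$; $\Gamma_i,\Delta_i$ meta-multiset variables and all variables of $\bar\phi_{ir}$ in $V(\phi)$. -}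

module Defs where

open import Data.Nat using (ℕ)
open import Data.Bool using (Bool; true; false; _∧_; _∨_; not)
open import Data.List using (List; []; _∷_; _++_; map; concat)
open import Data.List.Relation.Unary.All using (All)
open import Data.List.Relation.Binary.Permutation.Propositional using (_↭_)
open import Data.Vec using (Vec; lookup; toList)
import Data.Vec as Vec
open import Data.Fin using (Fin)
open import Data.Product using (_×_; _,_; proj₁; proj₂)
open import Relation.Binary.PropositionalEquality using (_≡_)

-- Formulas.  The same type serves for formulas (var n = atom p_n) and
-- for meta-formulas (var n = formula variable), instantiated by a
-- substitution σ : ℕ → Fm.

infixr 6 _∧̇_
infixr 5 _∨̇_
infixr 4 _⇒̇_

data Fm : Set where
  var  : ℕ → Fm
  ⊤̇ ⊥̇ : Fm
  ¬̇_   : Fm → Fm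
  _∧̇_ _∨̇_ _⇒̇_ : Fm → Fm → Fm

sub : (ℕ → Fm) → Fm → Fm
sub σ (var n)  = σ n
sub σ ⊤̇        = ⊤̇
sub σ ⊥̇        = ⊥̇
sub σ (¬̇ A)    = ¬̇ sub σ A
sub σ (A ∧̇ B)  = sub σ A ∧̇ sub σ B
sub σ (A ∨̇ B)  = sub σ A ∨̇ sub σ B
sub σ (A ⇒̇ B)  = sub σ A ⇒̇ sub σ B

data Occ (n : ℕ) : Fm → Set where
  here : Occ n (var n)
  ¬o   : ∀ {A} → Occ n A → Occ n (¬̇ A)
  ∧l   : ∀ {A B} → Occ n A → Occ n (A ∧̇ B)
  ∧r   : ∀ {A B} → Occ n B → Occ n (A ∧̇ B)
  ∨l   : ∀ {A B} → Occ n A → Occ n (A ∨̇ B)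
  ∨r   : ∀ {A B} → Occ n B → Occ n (A ∨̇ B)
  ⇒l   : ∀ {A B} → Occ n A → Occ n (A ⇒̇ B)
  ⇒r   : ∀ {A B} → Occ n B → Occ n (A ⇒̇ B)

⋀ : List Fm → Fm
⋀ []      = ⊤̇
⋀ (A ∷ Γ) = A ∧̇ ⋀ Γ

⋁ : List Fm → Fm
⋁ []      = ⊥̇
⋁ (A ∷ Δ) = A ∨̇ ⋁ Δ

eval : (ℕ → Bool) → Fm → Bool
eval v (var n) = v n
eval v ⊤̇       = true
eval v ⊥̇       = false
eval v (¬̇ A)   = not (eval v A)
eval v (A ∧̇ B) = eval v A ∧ eval v B
eval v (A ∨̇ B) = eval v A ∨ eval v B
eval v (A ⇒̇ B) = not (eval v A) ∨ eval v B

Taut : Fm → Set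
Taut φ = ∀ (v : ℕ → Bool) → eval v φ ≡ true

data IPC⊢ : Fm → Set where
  K    : ∀ A B → IPC⊢ (A ⇒̇ B ⇒̇ A)
  S    : ∀ A B C → IPC⊢ ((A ⇒̇ B ⇒̇ C) ⇒̇ (A ⇒̇ B) ⇒̇ A ⇒̇ C)
  ∧I   : ∀ A B → IPC⊢ (A ⇒̇ B ⇒̇ A ∧̇ B)
  ∧E₁  : ∀ A B → IPC⊢ (A ∧̇ B ⇒̇ A)
  ∧E₂  : ∀ A B → IPC⊢ (A ∧̇ B ⇒̇ B)
  ∨I₁  : ∀ A B → IPC⊢ (A ⇒̇ A ∨̇ B)
  ∨I₂  : ∀ A B → IPC⊢ (B ⇒̇ A ∨̇ B)
  ∨E   : ∀ A B C → IPC⊢ ((A ⇒̇ C) ⇒̇ (B ⇒̇ C) ⇒̇ A ∨̇ B ⇒̇ C)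
  ⊥E   : ∀ A → IPC⊢ (⊥̇ ⇒̇ A)
  ⊤I   : IPC⊢ ⊤̇
  ¬E   : ∀ A → IPC⊢ (¬̇ A ⇒̇ A ⇒̇ ⊥̇)
  ¬I   : ∀ A → IPC⊢ ((A ⇒̇ ⊥̇) ⇒̇ ¬̇ A)
  mp   : ∀ {A B} → IPC⊢ (A ⇒̇ B) → IPC⊢ A → IPC⊢ B

record IsLogic (L : Fm → Set) : Set where
  field
    closed-mp  : ∀ {A B} → L (A ⇒̇ B) → L A → L B
    closed-sub : ∀ (σ : ℕ → Fm) {A} → L A → L (sub σ A)

SubClassical : (Fm → Set) → Set
SubClassical L = ∀ φ → L φ → Taut φ

ExtendsIPC : (Fm → Set) → Set
ExtendsIPC L = ∀ φ → IPC⊢ φ → L φ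

-- Sequents: pairs of lists, read as multisets (derivability is closed
-- under permutation of either side).

Sequent : Set
Sequent = List Fm × List Fm

Ctx : Set
Ctx = List Fm × List Fm

data Side : Set where
  left right : Side

-- A focused rule.  `groups` lists, for i = 1..n, the premises sharing the
-- contexts Γᵢ, Δᵢ; each premise (indexed by r) is the multiset φ̄ᵢᵣ of
-- meta-formulas added on the side of the main formula.
record FocusedRule : Set where
  field
    side   : Side
    main   : Fm
    n      : ℕ
    groups : Vec (List (List Fm)) n
    vars-ok : ∀ (i : Fin n) →
      All (All (λ ψ → ∀ m → Occ m ψ → Occ m main)) (lookup groups i)

open FocusedRule public

premise : Side → (ℕ → Fm) → Ctx → List Fm → Sequent
premise left  σ (Γ , Δ) φs = (Γ ++ map (sub σ) φs , Δ)
premise right σ (Γ , Δ) φs = (Γ , map (sub σ) φs ++ Δ)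

conclusion : (R : FocusedRule) → (ℕ → Fm) → Vec Ctx (n R) → Sequent
conclusion R σ cs with side R
... | left  = (concat (toList (Vec.map proj₁ cs)) ++ (sub σ (main R) ∷ [])
              , concat (toList (Vec.map proj₂ cs)))
... | right = (concat (toList (Vec.map proj₁ cs))
              , concat (toList (Vec.map proj₂ cs)) ++ (sub σ (main R) ∷ []))

data AxiomKind : Set where
  idAx   : AxiomKind
  botAx  : AxiomKind
  topAx  : AxiomKind

record Calculus : Set₁ where
  field
    RuleIx : Set
    rule   : RuleIx → FocusedRule
    AxIx   : Set
    axiom  : AxIx → AxiomKind

open Calculus public

data _⊢_ (G : Calculus) : Sequent → Set where
  ax-id  : ∀ j → axiom G j ≡ idAx → ∀ r Γ Δ → G ⊢ (var r ∷ Γ , var r ∷ Δ)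
  ax-bot : ∀ j → axiom G j ≡ botAx → ∀ Γ Δ → G ⊢ (⊥̇ ∷ Γ , Δ)
  ax-top : ∀ j → axiom G j ≡ topAx → ∀ Γ Δ → G ⊢ (Γ , ⊤̇ ∷ Δ)
  apply  : ∀ k (σ : ℕ → Fm) (cs : Vec Ctx (n (rule G k))) →
           (∀ (i : Fin (n (rule G k))) →
              All (λ φs → G ⊢ premise (side (rule G k)) σ (lookup cs i) φs)
                  (lookup (groups (rule G k)) i)) →
           G ⊢ conclusion (rule G k) σ cs
  perm   : ∀ {Γ Γ' Δ Δ'} → Γ ↭ Γ' → Δ ↭ Δ' → G ⊢ (Γ , Δ) → G ⊢ (Γ' , Δ')

IsCalculusFor : Calculus → (Fm → Set) → Set
IsCalculusFor G L = ∀ Γ Δ → (G ⊢ (Γ , Δ) → L (⋀ Γ ⇒̇ ⋁ Δ)) × (L (⋀ Γ ⇒̇ ⋁ Δ) → G ⊢ (Γ , Δ))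

module Submission where

-- Substituting for the meta-variables of a rule the truth constants ⊤/⊥ given by a valuation v
-- turns its premises with empty contexts into closed sequents; IPC proves those that are true
-- under v, and G derives only tautologies, so every rule of G is classically sound when applied
-- with empty contexts. Because a focused rule keeps its principal formula apart from the contexts,
-- this soundness propagates to a two-valuation semantics reading antecedents under u and
-- succedents under w, for any u ≤ w; atomic axioms are valid there. With u all-false and
-- w all-true the IPC-theorem ¬p ⇒ ¬p is not.

open import Defs
open import Relation.Nullary using (¬_)
open import Data.Nat using (ℕ; zero; suc)
open import Data.Bool using (Bool; true; false; _∧_; _∨_; not; if_then_else_)
open import Data.Bool.Properties using (∧-conicalˡ; ∧-conicalʳ; ∨-conicalˡ; ∨-conicalʳ)
open import Data.List using (List; []; _∷_; _++_; map; concat)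
open import Data.List.Properties using (++-identityʳ)
open import Data.List.Relation.Unary.All as All using (All; []; _∷_)
open import Data.List.Relation.Unary.All.Properties using (++⁺; ++⁻ˡ; ++⁻ʳ; map⁺)
open import Data.List.Relation.Binary.Permutation.Propositional using (↭-sym)
open import Data.List.Relation.Binary.Permutation.Propositional.Properties using (All-resp-↭)
open import Data.Vec using (Vec; lookup; toList; _∷_)
import Data.Vec as Vec
open import Data.Vec.Properties using (lookup-replicate)
open import Data.Fin using (Fin; zero; suc)
open import Data.Product using (_,_; proj₁; proj₂)
open import Data.Empty using (⊥; ⊥-elim)
open import Function using (_∘_; _∋_)
open import Relation.Binary.PropositionalEquality

ipc-refl : ∀ A → IPC⊢ (A ⇒̇ A)
ipc-refl A = mp (mp (S A (A ⇒̇ A) A) (K A (A ⇒̇ A))) (K A A)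

ipc-const : ∀ {A B} → IPC⊢ B → IPC⊢ (A ⇒̇ B)
ipc-const {A} {B} b = mp (K B A) b

ipc-ap : ∀ {A B C} → IPC⊢ (A ⇒̇ B ⇒̇ C) → IPC⊢ (A ⇒̇ B) → IPC⊢ (A ⇒̇ C)
ipc-ap {A} {B} {C} f g = mp (mp (S A B C) f) g

ipc-trans : ∀ {A B C} → IPC⊢ (A ⇒̇ B) → IPC⊢ (B ⇒̇ C) → IPC⊢ (A ⇒̇ C)
ipc-trans f g = ipc-ap (ipc-const g) f

ipc-apply : ∀ {A B} → IPC⊢ A → IPC⊢ ((A ⇒̇ B) ⇒̇ B)
ipc-apply a = ipc-ap (ipc-refl _) (ipc-const a)

constSub : (ℕ → Bool) → ℕ → Fm
constSub v m = if v m then ⊤̇ else ⊥̇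

module _ (v : ℕ → Bool) where

  provable-constSub : ∀ A → eval v A ≡ true → IPC⊢ (sub (constSub v) A)
  refutable-constSub : ∀ A → eval v A ≡ false → IPC⊢ (sub (constSub v) A ⇒̇ ⊥̇)

  provable-constSub (var m) e with v m
  ... | true = ⊤I
  provable-constSub ⊤̇ _ = ⊤I
  provable-constSub (¬̇ A) e with eval v A in a
  ... | false = mp (¬I _) (refutable-constSub A a)
  provable-constSub (A ∧̇ B) e with eval v A in a | eval v B in b
  ... | true | true = mp (mp (∧I _ _) (provable-constSub A a)) (provable-constSub B b)
  provable-constSub (A ∨̇ B) e with eval v A in a | eval v B in b
  ... | true  | _    = mp (∨I₁ _ _) (provable-constSub A a)
  ... | false | true = mp (∨I₂ _ _) (provable-constSub B b)
  provable-constSub (A ⇒̇ B) e with eval v A in a | eval v B in b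
  ... | false | _    = ipc-trans (refutable-constSub A a) (⊥E _)
  ... | true  | true = ipc-const (provable-constSub B b)

  refutable-constSub (var m) e with v m
  ... | false = ipc-refl ⊥̇
  refutable-constSub ⊥̇ _ = ipc-refl ⊥̇
  refutable-constSub (¬̇ A) e with eval v A in a
  ... | true = ipc-ap (¬E _) (ipc-const (provable-constSub A a))
  refutable-constSub (A ∧̇ B) e with eval v A in a | eval v B in b
  ... | false | _     = ipc-trans (∧E₁ _ _) (refutable-constSub A a)
  ... | true  | false = ipc-trans (∧E₂ _ _) (refutable-constSub B b)
  refutable-constSub (A ∨̇ B) e with eval v A in a | eval v B in b
  ... | false | false = mp (mp (∨E _ _ _) (refutable-constSub A a)) (refutable-constSub B b)
  refutable-constSub (A ⇒̇ B) e with eval v A in a | eval v B in b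
  ... | true | false = ipc-trans (ipc-apply (provable-constSub A a)) (refutable-constSub B b)

eval-sub : ∀ u σ A → eval u (sub σ A) ≡ eval (eval u ∘ σ) A
eval-sub u σ (var m)  = refl
eval-sub u σ ⊤̇        = refl
eval-sub u σ ⊥̇        = refl
eval-sub u σ (¬̇ A)    = cong not (eval-sub u σ A)
eval-sub u σ (A ∧̇ B)  = cong₂ _∧_ (eval-sub u σ A) (eval-sub u σ B)
eval-sub u σ (A ∨̇ B)  = cong₂ _∨_ (eval-sub u σ A) (eval-sub u σ B)
eval-sub u σ (A ⇒̇ B)  = cong₂ (λ a b → not a ∨ b) (eval-sub u σ A) (eval-sub u σ B)

eval-cong : ∀ {u v} → (∀ m → u m ≡ v m) → ∀ A → eval u A ≡ eval v A
eval-cong u≗v (var m)  = u≗v m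
eval-cong u≗v ⊤̇        = refl
eval-cong u≗v ⊥̇        = refl
eval-cong u≗v (¬̇ A)    = cong not (eval-cong u≗v A)
eval-cong u≗v (A ∧̇ B)  = cong₂ _∧_ (eval-cong u≗v A) (eval-cong u≗v B)
eval-cong u≗v (A ∨̇ B)  = cong₂ _∨_ (eval-cong u≗v A) (eval-cong u≗v B)
eval-cong u≗v (A ⇒̇ B)  = cong₂ (λ a b → not a ∨ b) (eval-cong u≗v A) (eval-cong u≗v B)

eval-constSub : ∀ u v A → eval u (sub (constSub v) A) ≡ eval v A
eval-constSub u v A = trans (eval-sub u (constSub v) A) (eval-cong eval-const A)
  where
    eval-const : ∀ m → eval u (constSub v m) ≡ v m
    eval-const m with v m
    ... | true  = refl
    ... | false = refl

⟦_⟧ : Sequent → Fm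
⟦ Γ , Δ ⟧ = ⋀ Γ ⇒̇ ⋁ Δ

subSeq : (ℕ → Fm) → Sequent → Sequent
subSeq σ (Γ , Δ) = map (sub σ) Γ , map (sub σ) Δ

sub-⋀ : ∀ σ Γ → sub σ (⋀ Γ) ≡ ⋀ (map (sub σ) Γ)
sub-⋀ σ []      = refl
sub-⋀ σ (A ∷ Γ) = cong (sub σ A ∧̇_) (sub-⋀ σ Γ)

sub-⋁ : ∀ σ Δ → sub σ (⋁ Δ) ≡ ⋁ (map (sub σ) Δ)
sub-⋁ σ []      = refl
sub-⋁ σ (A ∷ Δ) = cong (sub σ A ∨̇_) (sub-⋁ σ Δ)

sub-⟦⟧ : ∀ σ s → sub σ ⟦ s ⟧ ≡ ⟦ subSeq σ s ⟧
sub-⟦⟧ σ (Γ , Δ) = cong₂ _⇒̇_ (sub-⋀ σ Γ) (sub-⋁ σ Δ)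

Valid : (ℕ → Bool) → (ℕ → Bool) → Sequent → Set
Valid u w (Γ , Δ) = All (λ A → eval u A ≡ true) Γ → All (λ A → eval w A ≡ false) Δ → ⊥

_⊨_ : (ℕ → Bool) → Sequent → Set
v ⊨ s = Valid v v s

⋀-true⁻ : ∀ {v} Γ → eval v (⋀ Γ) ≡ true → All (λ A → eval v A ≡ true) Γ
⋀-true⁻ []      _ = []
⋀-true⁻ (A ∷ Γ) e = ∧-conicalˡ _ _ e ∷ ⋀-true⁻ Γ (∧-conicalʳ _ _ e)

⋀-true⁺ : ∀ {v Γ} → All (λ A → eval v A ≡ true) Γ → eval v (⋀ Γ) ≡ true
⋀-true⁺ []       = refl
⋀-true⁺ (e ∷ es) = cong₂ _∧_ e (⋀-true⁺ es)

⋁-false⁻ : ∀ {v} Δ → eval v (⋁ Δ) ≡ false → All (λ A → eval v A ≡ false) Δ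
⋁-false⁻ []      _ = []
⋁-false⁻ (A ∷ Δ) e = ∨-conicalˡ _ _ e ∷ ⋁-false⁻ Δ (∨-conicalʳ _ _ e)

⋁-false⁺ : ∀ {v Δ} → All (λ A → eval v A ≡ false) Δ → eval v (⋁ Δ) ≡ false
⋁-false⁺ []       = refl
⋁-false⁺ (e ∷ es) = cong₂ _∨_ e (⋁-false⁺ es)

⊨⇒eval : ∀ {v} s → v ⊨ s → eval v ⟦ s ⟧ ≡ true
⊨⇒eval {v} (Γ , Δ) valid with eval v (⋀ Γ) in eΓ | eval v (⋁ Δ) in eΔ
... | false | _     = refl
... | true  | true  = refl
... | true  | false = ⊥-elim (valid (⋀-true⁻ Γ eΓ) (⋁-false⁻ Δ eΔ))

eval⇒⊨ : ∀ {v} s → eval v ⟦ s ⟧ ≡ true → v ⊨ s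
eval⇒⊨ {v} (Γ , Δ) e aΓ aΔ
  with () ← trans (sym e) (cong₂ (λ a b → not a ∨ b) (⋀-true⁺ aΓ) (⋁-false⁺ aΔ))

oneSided : Side → List Fm → Sequent
oneSided left  φs = φs , []
oneSided right φs = [] , φs

SoundRule : FocusedRule → Set
SoundRule R = ∀ v → (∀ i → All (λ φs → v ⊨ oneSided (side R) φs) (lookup (groups R) i)) →
  v ⊨ oneSided (side R) (main R ∷ [])

emptyCtxs : ∀ m → Vec Ctx m
emptyCtxs m = Vec.replicate m ([] , [])

premise-emptyCtxs : ∀ {m} s σ (i : Fin m) φs →
  premise s σ (lookup (emptyCtxs m) i) φs ≡ subSeq σ (oneSided s φs)
premise-emptyCtxs s σ i φs rewrite lookup-replicate i (Ctx ∋ ([] , [])) with s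
... | left  = refl
... | right = cong ([] ,_) (++-identityʳ (map (sub σ) φs))

antecedents succedents : ∀ {m} → Vec Ctx m → List Fm
antecedents cs = concat (toList (Vec.map proj₁ cs))
succedents  cs = concat (toList (Vec.map proj₂ cs))

antecedents-emptyCtxs : ∀ m → antecedents (emptyCtxs m) ≡ []
antecedents-emptyCtxs zero    = refl
antecedents-emptyCtxs (suc m) = antecedents-emptyCtxs m

succedents-emptyCtxs : ∀ m → succedents (emptyCtxs m) ≡ []
succedents-emptyCtxs zero    = refl
succedents-emptyCtxs (suc m) = succedents-emptyCtxs m

conclusion-emptyCtxs : ∀ R σ →
  conclusion R σ (emptyCtxs (n R)) ≡ subSeq σ (oneSided (side R) (main R ∷ []))
conclusion-emptyCtxs R σ
  with side R | antecedents-emptyCtxs (n R) | succedents-emptyCtxs (n R)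
... | left  | eΓ | eΔ rewrite eΓ | eΔ = refl
... | right | eΓ | eΔ rewrite eΓ | eΔ = refl

module _ {G : Calculus}
         (ipc⇒G : ∀ {s} → IPC⊢ ⟦ s ⟧ → G ⊢ s)
         (G⇒taut : ∀ {s} → G ⊢ s → Taut ⟦ s ⟧) where

  ⊨⇒⊢-constSub : ∀ v s → v ⊨ s → G ⊢ subSeq (constSub v) s
  ⊨⇒⊢-constSub v s valid =
    ipc⇒G (subst IPC⊢ (sub-⟦⟧ (constSub v) s) (provable-constSub v ⟦ s ⟧ (⊨⇒eval s valid)))

  ⊢-constSub⇒⊨ : ∀ v s → G ⊢ subSeq (constSub v) s → v ⊨ s
  ⊢-constSub⇒⊨ v s d = eval⇒⊨ s (begin
    eval v ⟦ s ⟧                        ≡⟨ eval-constSub v v ⟦ s ⟧ ⟨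
    eval v (sub (constSub v) ⟦ s ⟧)     ≡⟨ cong (eval v) (sub-⟦⟧ (constSub v) s) ⟩
    eval v ⟦ subSeq (constSub v) s ⟧    ≡⟨ G⇒taut d v ⟩
    true                                ∎)
    where open ≡-Reasoning

  rules-sound : ∀ k → SoundRule (rule G k)
  rules-sound k v premises-valid = ⊢-constSub⇒⊨ v (oneSided (side R) (main R ∷ []))
    (subst (G ⊢_) (conclusion-emptyCtxs R τ) (apply k τ (emptyCtxs (n R)) premises-derivable))
    where
      R = rule G k
      τ = constSub v
      premises-derivable : ∀ i →
        All (λ φs → G ⊢ premise (side R) τ (lookup (emptyCtxs (n R)) i) φs) (lookup (groups R) i)
      premises-derivable i = All.map
        (λ {φs} valid → subst (G ⊢_) (sym (premise-emptyCtxs (side R) τ i φs))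
                                     (⊨⇒⊢-constSub v (oneSided (side R) φs) valid))
        (premises-valid i)

All-concat-lookup : ∀ {P : Fm → Set} {m} (f : Ctx → List Fm) (cs : Vec Ctx m) →
  All P (concat (toList (Vec.map f cs))) → ∀ i → All P (f (lookup cs i))
All-concat-lookup f (c ∷ cs) all zero    = ++⁻ˡ (f c) all
All-concat-lookup f (c ∷ cs) all (suc i) = All-concat-lookup f cs (++⁻ʳ (f c) all) i

All-eval-sub : ∀ {u σ b} φs →
  All (λ A → eval (eval u ∘ σ) A ≡ b) φs → All (λ A → eval u A ≡ b) (map (sub σ) φs)
All-eval-sub {u} {σ} φs all = map⁺ (All.map (λ {A} e → trans (eval-sub u σ A) e) all)

module _ {u w : ℕ → Bool} where

  valid-conclusion : ∀ R → SoundRule R → ∀ σ cs →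
    (∀ i → All (λ φs → Valid u w (premise (side R) σ (lookup cs i) φs)) (lookup (groups R) i)) →
    Valid u w (conclusion R σ cs)
  valid-conclusion R sound σ cs premises-valid with side R
  ... | left = λ aΓ aΔ →
    let main-true = All.head (++⁻ʳ (antecedents cs) aΓ)
        Γᵢ-true = All-concat-lookup proj₁ cs (++⁻ˡ (antecedents cs) aΓ)
        Δᵢ-false = All-concat-lookup proj₂ cs aΔ
    in sound (eval u ∘ σ)
         (λ i → All.map (λ {φs} valid φs-true _ →
                           valid (++⁺ (Γᵢ-true i) (All-eval-sub φs φs-true)) (Δᵢ-false i))
                        (premises-valid i))
         (trans (sym (eval-sub u σ (main R))) main-true ∷ []) []
  ... | right = λ aΓ aΔ →
    let main-false = All.head (++⁻ʳ (succedents cs) aΔ)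
        Γᵢ-true = All-concat-lookup proj₁ cs aΓ
        Δᵢ-false = All-concat-lookup proj₂ cs (++⁻ˡ (succedents cs) aΔ)
    in sound (eval w ∘ σ)
         (λ i → All.map (λ {φs} valid _ φs-false →
                           valid (Γᵢ-true i) (++⁺ (All-eval-sub φs φs-false) (Δᵢ-false i)))
                        (premises-valid i))
         [] (trans (sym (eval-sub w σ (main R))) main-false ∷ [])

  module _ {G : Calculus} (sound : ∀ k → SoundRule (rule G k))
           (u≤w : ∀ r → u r ≡ true → w r ≡ true) where

    valid-derivable : ∀ {s} → G ⊢ s → Valid u w s
    valid-premises : ∀ {sd σ c φss} → All (λ φs → G ⊢ premise sd σ c φs) φss →
      All (λ φs → Valid u w (premise sd σ c φs)) φss

    valid-derivable (ax-id _ _ r _ _) (ur ∷ _) (wr ∷ _) with () ← trans (sym (u≤w r ur)) wr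
    valid-derivable (ax-bot _ _ _ _) (() ∷ _)
    valid-derivable (ax-top _ _ _ _) _ (() ∷ _)
    valid-derivable (apply k σ cs ds) =
      valid-conclusion (rule G k) (sound k) σ cs (λ i → valid-premises (ds i))
    valid-derivable (perm Γ↭Γ' Δ↭Δ' d) aΓ aΔ =
      valid-derivable d (All-resp-↭ (↭-sym Γ↭Γ') aΓ) (All-resp-↭ (↭-sym Δ↭Δ') aΔ)

    valid-premises []       = []
    valid-premises (d ∷ ds) = valid-derivable d ∷ valid-premises ds

corollary5p4 : (L : Fm → Set) → IsLogic L → SubClassical L → ExtendsIPC L →
    (G : Calculus) → ¬ IsCalculusFor G L
corollary5p4 L _ sub-classical extends-IPC G G-for-L =
  valid-derivable {u = λ _ → false} {w = λ _ → true} (rules-sound ipc⇒G G⇒taut) (λ _ ())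
    (ipc⇒G ¬p⇒¬p) (refl ∷ []) (refl ∷ [])
  where
    ipc⇒G : ∀ {s} → IPC⊢ ⟦ s ⟧ → G ⊢ s
    ipc⇒G {Γ , Δ} p = proj₂ (G-for-L Γ Δ) (extends-IPC _ p)

    G⇒taut : ∀ {s} → G ⊢ s → Taut ⟦ s ⟧
    G⇒taut {Γ , Δ} d = sub-classical _ (proj₁ (G-for-L Γ Δ) d)

    ¬p⇒¬p : IPC⊢ ⟦ ¬̇ var 0 ∷ [] , ¬̇ var 0 ∷ [] ⟧
    ¬p⇒¬p = ipc-trans (∧E₁ _ _) (∨I₁ _ _)
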